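{- Let $\mathcal F$ be a finite set, $k\ge 1$ an integer, $S_1,\ldots,S_k$ multisets of subsets of $\mathcal F$ (copies of equal subsets being treated as distinct elements), and $\mathcal F_k\subseteq \mathcal F\times S_1\times\cdots\times S_k$ such that every $(G,C_1,\ldots,C_k)\in\mathcal F_k$ satisfies $G\in C_k\subseteq\cdots\subseteq C_1$. For $1\le i<k$ let $\mathcal F_i=\{(G,C_1,\ldots,C_i):(G,C_1,\ldots,C_k)\in\mathcal F_k\}$, and $\mathcal F_0=\mathcal F$. For $i\in[k]$ and $F=(G,C_1,\ldots,C_i)\in\mathcal F_i$ put $P(F)=(G,C_1,\ldots,C_{i-1})$. For $0\le i\le k-1$ and $F\in\mathcal F_i$ let $b(F)$ be the number of $F'\in\mathcal F_{i+1}$ with $P(F')=F$, and let $\underline b(i)\le b(F)$ for all $F\in\mathcal F_i$. The procedure $\mathrm{Loosen}(F)$, for $F\in\mathcal F_i$, $i\ge1$, outputs $P(F)$ with probability $\underline b(i-1)/b(P(F))$ and otherwise rejects. The procedure $\mathrm{Relax}(F)$, for $F\in\mathcal F_k$, applies $\mathrm{Loosen}$ successively $k$ times (to $F$, then to the output, etc.), stopping with rejection if any call rejects, and otherwise outputs the resulting $G\in\mathcal F_0$. Assume $\underline b(i-1)>0$ for all $i\in[k]$, and $F$ is chosen uniformly at random from $\mathcal F_k$. Then, conditional on no rejection, the output of $\mathrm{Relax}(F)$ is uniformly distributed on $\mathcal F$. -}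

module Defs where

open import Data.Nat using (ℕ; zero; suc; _∸_)
open import Data.Fin using (Fin; _≟_)
open import Data.Fin.Subset using (Subset; _∈_; _⊆_)
open import Data.List using (List; []; _∷_; length; map; take; filter; deduplicate; allFin; concatMap; foldr)
import Data.List.Properties as LP
import Data.Nat as ℕ
open import Data.Maybe using (Maybe; just; nothing; is-just)
open import Data.Product using (_×_; _,_; Σ; proj₁; proj₂)
import Data.Product.Properties as PP
open import Data.Bool using (Bool; if_then_else_)
open import Data.Unit using (⊤)
open import Data.Integer using (+_)
open import Data.Rational using (ℚ; _/_; _+_; _*_; _-_; 0ℚ; 1ℚ)
open import Relation.Binary.PropositionalEquality using (_≡_)
open import Relation.Binary using (DecidableEquality)
open import Relation.Nullary using (does)

-- 𝓕 = Fin n.  The multisets S_1,…,S_k are given as a list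
-- S = [S_1, …, S_k] of lists of subsets of Fin n; an element of the
-- multiset S_j is a position in the list S_j (so copies of equal
-- subsets are distinct elements).  A tuple (G, C_1, …, C_i) is
-- represented as (G , [c_1, …, c_i]) where c_j ∈ ℕ is the position of
-- C_j in S_j.

Tuple : ℕ → Set
Tuple n = Fin n × List ℕ

_≟T_ : ∀ {n} → DecidableEquality (Tuple n)
_≟T_ = PP.≡-dec _≟_ (LP.≡-dec ℕ._≟_)

pick : ∀ {n} → List (Subset n) → ℕ → Maybe (Subset n)
pick []       _       = nothing
pick (x ∷ xs) zero    = just x
pick (x ∷ xs) (suc c) = pick xs c

data Resolves {n : ℕ} : List (List (Subset n)) → List ℕ → List (Subset n) → Set where
  []  : Resolves [] [] []
  _∷_ : ∀ {Sj c C Ss cs Cs} → pick Sj c ≡ just C → Resolves Ss cs Cs →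
        Resolves (Sj ∷ Ss) (c ∷ cs) (C ∷ Cs)

Chain : ∀ {n} → Fin n → List (Subset n) → Set
Chain G []            = ⊤
Chain G (C ∷ [])      = G ∈ C
Chain G (C ∷ D ∷ Ds)  = D ⊆ C × Chain G (D ∷ Ds)

Valid : ∀ {n} → List (List (Subset n)) → Tuple n → Set
Valid S (G , cs) = Σ (List (Subset _)) λ Cs → Resolves S cs Cs × Chain G Cs

dropLast : List ℕ → List ℕ
dropLast []           = []
dropLast (x ∷ [])     = []
dropLast (x ∷ y ∷ ys) = x ∷ dropLast (y ∷ ys)

P : ∀ {n} → Tuple n → Tuple n
P (G , cs) = G , dropLast cs

Level : ∀ {n} → List (Tuple n) → ℕ → List (Tuple n)
Level {n} Fk zero    = map (λ G → G , []) (allFin n)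
Level {n} Fk (suc i) = deduplicate _≟T_ (map (λ F → proj₁ F , take (suc i) (proj₂ F)) Fk)

b : ∀ {n} → List (Tuple n) → Tuple n → ℕ
b Fk F = length (filter (λ F' → P F' ≟T F) (Level Fk (suc (length (proj₂ F)))))

Dist : Set → Set
Dist A = List (ℚ × A)

return : ∀ {A} → A → Dist A
return a = (1ℚ , a) ∷ []

_>>=_ : ∀ {A B} → Dist A → (A → Dist B) → Dist B
d >>= f = concatMap (λ pa → map (λ qb → (proj₁ pa * proj₁ qb , proj₂ qb)) (f (proj₂ pa))) d

-- uniform distribution on a (duplicate-free) nonempty list
uniform : ∀ {A} → List A → Dist A
uniform []         = []
uniform (x ∷ xs)   = map (λ a → (+ 1 / suc (length xs)) , a) (x ∷ xs)

Pr : ∀ {A} → Dist A → (A → Bool) → ℚ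
Pr d E = foldr (λ pa acc → if E (proj₂ pa) then proj₁ pa + acc else acc) 0ℚ d

-- The procedures (nothing = rejection)

-- Loosen(F), F ∈ 𝓕_i (i ≥ 1): output P(F) with probability
-- b̲(i-1)/b(P(F)), otherwise reject.  (The case b(P(F)) = 0 never
-- arises under the hypotheses; there we simply reject.)
Loosen : ∀ {n} → List (Tuple n) → (ℕ → ℕ) → Tuple n → Dist (Maybe (Tuple n))
Loosen Fk bl F with b Fk (P F)
... | zero  = (1ℚ , nothing) ∷ []
... | suc m = (p , just (P F)) ∷ (1ℚ - p , nothing) ∷ []
  where p = + bl (length (proj₂ F) ∸ 1) / suc m

loosenIter : ∀ {n} → List (Tuple n) → (ℕ → ℕ) → ℕ → Maybe (Tuple n) → Dist (Maybe (Tuple n))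
loosenIter Fk bl zero    x        = return x
loosenIter Fk bl (suc j) nothing  = return nothing
loosenIter Fk bl (suc j) (just F) = Loosen Fk bl F >>= loosenIter Fk bl j

Relax : ∀ {n} → List (Tuple n) → (ℕ → ℕ) → ℕ → Tuple n → Dist (Maybe (Fin n))
Relax Fk bl k F = loosenIter Fk bl k (just F) >>= λ
  { nothing        → return nothing
  ; (just (G , _)) → return (just G) }

experiment : ∀ {n} → List (Tuple n) → (ℕ → ℕ) → ℕ → Dist (Maybe (Fin n))
experiment Fk bl k = uniform Fk >>= Relax Fk bl k

accepted : ∀ {n} → Maybe (Fin n) → Bool
accepted = is-just

outputIs : ∀ {n} → Fin n → Maybe (Fin n) → Bool
outputIs G nothing   = Data.Bool.false
outputIs G (just G') = does (G ≟ G')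

module Submission where

-- Fix an event E on outputs that excludes rejection, and let W j F be the
-- probability that j rounds of Loosen started at F are all accepted and end
-- in a tuple whose ground element G satisfies E.  One round of Loosen gives
--   W (j+1) F = b̲(i-1) / b(P F) · W j (P F)        for F ∈ 𝓕_i.
-- Summing over 𝓕_{i+1} and grouping the summands by their parent in 𝓕_i,
-- every F ∈ 𝓕_i occurs exactly b(F) times, which cancels the acceptance
-- probability:  Σ_{𝓕_{i+1}} W (i+1) = b̲(i) · Σ_{𝓕_i} W i.  Iterating from
-- 𝓕_0 = 𝓕 to 𝓕_k gives
--   Pr[output ∈ E] = 1/|𝓕_k| · ∏_{i<k} b̲(i) · #{G ∈ 𝓕 : G ∈ E},
-- which depends on E only through its size.  Taking E = "accepted" and
-- E = "output is G" gives both claims of the corollary.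

open import Defs
open import Data.Nat using (ℕ; _≤_; _<_)
open import Data.Fin using (Fin)
open import Data.Fin.Subset using (Subset)
open import Data.List using (List; []; length)
open import Data.List.Membership.Propositional using (_∈_)
open import Data.List.Relation.Unary.Unique.Propositional using (Unique)
open import Data.Product using (_×_)
open import Data.Integer using (+_)
open import Data.Rational using (ℚ; _/_; _*_; 0ℚ) renaming (_<_ to _<ℚ_)
open import Relation.Binary.PropositionalEquality using (_≡_; _≢_)

open import Algebra.Bundles using (CommutativeMonoid)
open import Data.Bool using (Bool; true; false; if_then_else_)
open import Data.Empty using (⊥-elim)
import Data.Fin as Fin
import Data.Integer as ℤ
open import Data.Integer.Tactic.RingSolver using (solve-∀)
import Data.Integer.Properties as ℤP
open import Data.List using (_∷_; _++_; map; filter; take; foldr; deduplicate; allFin)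
import Data.List.Properties as LP
open import Data.List.Membership.Propositional.Properties
  using (∈-map⁺; ∈-map⁻; ∈-allFin; ∈-deduplicate⁺; ∈-deduplicate⁻)
open import Data.List.Relation.Unary.All as All using (All)
open import Data.List.Relation.Unary.AllPairs using (_∷_)
open import Data.List.Relation.Unary.Any using (here; there)
import Data.List.Relation.Unary.Unique.Propositional.Properties as UniqueP
import Data.List.Relation.Unary.Unique.DecPropositional.Properties as UniqueDecP
open import Data.Maybe using (Maybe; just; nothing)
open import Data.Nat as ℕ using (zero; suc; _∸_; s≤s)
import Data.Nat.Properties as ℕP
open import Data.Product using (∃; _,_; proj₁; proj₂)
open import Data.Rational using (_+_; _-_; 1ℚ; toℚᵘ; Positive)
open import Data.Rational.Properties
  using (toℚᵘ-fromℚᵘ; toℚᵘ-injective; toℚᵘ-homo-+; toℚᵘ-homo-*; normalize-pos;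
         +-identityˡ; +-identityʳ; *-identityˡ; *-identityʳ; *-zeroˡ; *-zeroʳ;
         +-assoc; *-assoc; *-distribˡ-+; *-distribʳ-+; pos*pos⇒pos; positive⁻¹;
         +-0-commutativeMonoid)
import Data.Rational.Unnormalised as U
import Data.Rational.Unnormalised.Properties as UP
open import Relation.Binary using (DecidableEquality)
open import Relation.Binary.PropositionalEquality
  using (refl; sym; trans; cong; cong₂; subst; module ≡-Reasoning)
open import Relation.Nullary using (yes; no; does; ¬?)

open import Algebra.Properties.CommutativeSemigroup
  (CommutativeMonoid.commutativeSemigroup +-0-commutativeMonoid) using (interchange)

private
  variable
    A B : Set

ι : ℕ → ℚ
ι m = + m / 1

-- A fraction with positive denominator, read as an unnormalised rational.
-- Both arithmetic facts below are checked on unnormalised representatives.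
toℚᵘ-/suc : ∀ x d → toℚᵘ (x / suc d) U.≃ U.mkℚᵘ x d
toℚᵘ-/suc x d = toℚᵘ-fromℚᵘ (U.mkℚᵘ x d)

ι-homo-+ : ∀ a b → ι (a ℕ.+ b) ≡ ι a + ι b
ι-homo-+ a b = toℚᵘ-injective (begin
    toℚᵘ (ι (a ℕ.+ b))                 ≈⟨ toℚᵘ-/suc (+ (a ℕ.+ b)) 0 ⟩
    U.mkℚᵘ (+ (a ℕ.+ b)) 0             ≈⟨ U.*≡* (trans (cong (ℤ._* + 1) (ℤP.pos-+ a b)) (ring (+ a) (+ b))) ⟩
    U.mkℚᵘ (+ a) 0 U.+ U.mkℚᵘ (+ b) 0  ≈⟨ UP.≃-sym (UP.+-cong (toℚᵘ-/suc (+ a) 0) (toℚᵘ-/suc (+ b) 0)) ⟩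
    toℚᵘ (ι a) U.+ toℚᵘ (ι b)          ≈⟨ UP.≃-sym (toℚᵘ-homo-+ (ι a) (ι b)) ⟩
    toℚᵘ (ι a + ι b)                   ∎)
  where
  open UP.≃-Reasoning
  ring : ∀ (x y : ℤ.ℤ) → (x ℤ.+ y) ℤ.* + 1 ≡ (x ℤ.* + 1 ℤ.+ y ℤ.* + 1) ℤ.* + 1
  ring = solve-∀

ι-suc-* : ∀ c x → x + ι c * x ≡ ι (suc c) * x
ι-suc-* c x = begin
  x + ι c * x       ≡⟨ cong (_+ ι c * x) (sym (*-identityˡ x)) ⟩
  1ℚ * x + ι c * x  ≡⟨ sym (*-distribʳ-+ x 1ℚ (ι c)) ⟩
  (1ℚ + ι c) * x    ≡⟨ cong (_* x) (sym (ι-homo-+ 1 c)) ⟩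
  ι (suc c) * x     ∎
  where open ≡-Reasoning

ι-*-/ : ∀ a m → ι (suc m) * (+ a / suc m) ≡ ι a
ι-*-/ a m = toℚᵘ-injective (begin
    toℚᵘ (ι (suc m) * (+ a / suc m))         ≈⟨ toℚᵘ-homo-* (ι (suc m)) (+ a / suc m) ⟩
    toℚᵘ (ι (suc m)) U.* toℚᵘ (+ a / suc m)  ≈⟨ UP.*-cong (toℚᵘ-/suc (+ suc m) 0) (toℚᵘ-/suc (+ a) m) ⟩
    U.mkℚᵘ (+ suc m) 0 U.* U.mkℚᵘ (+ a) m    ≈⟨ U.*≡* (trans (ring (+ suc m) (+ a)) denominator) ⟩
    U.mkℚᵘ (+ a) 0                           ≈⟨ UP.≃-sym (toℚᵘ-/suc (+ a) 0) ⟩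
    toℚᵘ (ι a)                               ∎)
  where
  open UP.≃-Reasoning
  ring : ∀ (d x : ℤ.ℤ) → (d ℤ.* x) ℤ.* + 1 ≡ x ℤ.* d
  ring = solve-∀
  denominator : + a ℤ.* + suc m ≡ + a ℤ.* + suc (m ℕ.+ 0)
  denominator = cong (λ t → + a ℤ.* + suc t) (sym (ℕP.+-identityʳ m))

ι-pos : ∀ m → 0 < m → Positive (ι m)
ι-pos (suc m) _ = normalize-pos (suc m) 1

ι-pos-Fin : ∀ {n} → Fin n → Positive (ι n)
ι-pos-Fin {suc n} _ = normalize-pos (suc n) 1

∑ : List A → (A → ℚ) → ℚ
∑ l f = foldr (λ x acc → f x + acc) 0ℚ l

∑-cong∈ : ∀ (l : List A) {f g : A → ℚ} → (∀ x → x ∈ l → f x ≡ g x) → ∑ l f ≡ ∑ l g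
∑-cong∈ []      eq = refl
∑-cong∈ (x ∷ l) eq = cong₂ _+_ (eq x (here refl)) (∑-cong∈ l (λ y y∈ → eq y (there y∈)))

∑-zero : ∀ (l : List A) f → (∀ x → x ∈ l → f x ≡ 0ℚ) → ∑ l f ≡ 0ℚ
∑-zero l f eq = trans (∑-cong∈ l eq) (zeros l)
  where
  zeros : ∀ (l : List A) → ∑ l (λ _ → 0ℚ) ≡ 0ℚ
  zeros []      = refl
  zeros (_ ∷ l) = trans (+-identityˡ _) (zeros l)

∑-++ : ∀ (l m : List A) f → ∑ (l ++ m) f ≡ ∑ l f + ∑ m f
∑-++ []      m f = sym (+-identityˡ _)
∑-++ (x ∷ l) m f = trans (cong (_+_ (f x)) (∑-++ l m f)) (sym (+-assoc (f x) (∑ l f) (∑ m f)))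

∑-+ : ∀ (l : List A) f g → ∑ l (λ x → f x + g x) ≡ ∑ l f + ∑ l g
∑-+ []      f g = refl
∑-+ (x ∷ l) f g =
  trans (cong (_+_ (f x + g x)) (∑-+ l f g)) (interchange (f x) (g x) (∑ l f) (∑ l g))

∑-*ˡ : ∀ (l : List A) c f → ∑ l (λ x → c * f x) ≡ c * ∑ l f
∑-*ˡ []      c f = sym (*-zeroʳ c)
∑-*ˡ (x ∷ l) c f = trans (cong (_+_ (c * f x)) (∑-*ˡ l c f)) (sym (*-distribˡ-+ c (f x) (∑ l f)))

∑-map : ∀ (h : A → B) (l : List A) f → ∑ (map h l) f ≡ ∑ l (λ x → f (h x))
∑-map h []      f = refl
∑-map h (x ∷ l) f = cong (_+_ (f (h x))) (∑-map h l f)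

∑-const : ∀ (l : List A) c → ∑ l (λ _ → c) ≡ ι (length l) * c
∑-const []      c = sym (*-zeroˡ c)
∑-const (x ∷ l) c = trans (cong (_+_ c) (∑-const l c)) (ι-suc-* (length l) c)

module _ (_≟A_ : DecidableEquality A) where

  atPoint : A → (A → ℚ) → A → ℚ
  atPoint y f z = if does (y ≟A z) then f z else 0ℚ

  fiberSize : (B → A) → List B → A → ℕ
  fiberSize π L y = length (filter (λ x → π x ≟A y) L)

  ∑-atPoint : ∀ (l : List A) → Unique l → ∀ {y} → y ∈ l → (f : A → ℚ) → ∑ l (atPoint y f) ≡ f y
  ∑-atPoint (z ∷ zs) (z∉zs ∷ _) {y} (here refl) f with y ≟A y
  ... | no  y≢y = ⊥-elim (y≢y refl)
  ... | yes _   = trans (cong (_+_ (f y)) (∑-zero zs (atPoint y f) elsewhere)) (+-identityʳ (f y))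
    where
    elsewhere : ∀ w → w ∈ zs → atPoint y f w ≡ 0ℚ
    elsewhere w w∈ with y ≟A w
    ... | no  _   = refl
    ... | yes y≡w = ⊥-elim (All.lookup z∉zs w∈ y≡w)
  ∑-atPoint (z ∷ zs) (z∉zs ∷ u) {y} (there y∈) f with y ≟A z
  ... | yes refl = ⊥-elim (All.lookup z∉zs y∈ refl)
  ... | no  _    = trans (+-identityˡ _) (∑-atPoint zs u y∈ f)

  ∑-fibers : ∀ (π : B → A) (L' : List A) → Unique L' → (L : List B) →
             (∀ x → x ∈ L → π x ∈ L') → (f : A → ℚ) →
             ∑ L (λ x → f (π x)) ≡ ∑ L' (λ y → ι (fiberSize π L y) * f y)
  ∑-fibers π L' u []      _      f = sym (∑-zero L' _ (λ y _ → *-zeroˡ (f y)))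
  ∑-fibers π L' u (x ∷ L) π[L]⊆L' f = begin
      f (π x) + ∑ L (λ x → f (π x))
        ≡⟨ cong₂ _+_ (sym (∑-atPoint L' u (π[L]⊆L' x (here refl)) f))
                     (∑-fibers π L' u L (λ z z∈ → π[L]⊆L' z (there z∈)) f) ⟩
      ∑ L' (atPoint (π x) f) + ∑ L' (λ y → ι (fiberSize π L y) * f y)
        ≡⟨ sym (∑-+ L' (atPoint (π x) f) _) ⟩
      ∑ L' (λ y → atPoint (π x) f y + ι (fiberSize π L y) * f y)
        ≡⟨ ∑-cong∈ L' (λ y _ → addOne y) ⟩
      ∑ L' (λ y → ι (fiberSize π (x ∷ L) y) * f y) ∎
    where
    open ≡-Reasoning
    addOne : ∀ y → atPoint (π x) f y + ι (fiberSize π L y) * f y ≡ ι (fiberSize π (x ∷ L) y) * f y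
    addOne y with π x ≟A y
    ... | yes _ = ι-suc-* (fiberSize π L y) (f y)
    ... | no  _ = +-identityˡ _

𝔼 : Dist A → (A → ℚ) → ℚ
𝔼 d g = ∑ d (λ pa → proj₁ pa * g (proj₂ pa))

ind : (A → Bool) → A → ℚ
ind E a = if E a then 1ℚ else 0ℚ

Pr-𝔼 : ∀ (d : Dist A) E → Pr d E ≡ 𝔼 d (ind E)
Pr-𝔼 []            E = refl
Pr-𝔼 ((p , a) ∷ d) E with E a
... | true  = cong₂ _+_ (sym (*-identityʳ p)) (Pr-𝔼 d E)
... | false = trans (sym (+-identityˡ _)) (cong₂ _+_ (sym (*-zeroʳ p)) (Pr-𝔼 d E))

𝔼-cong : ∀ (d : Dist A) {g h : A → ℚ} → (∀ a → g a ≡ h a) → 𝔼 d g ≡ 𝔼 d h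
𝔼-cong d eq = ∑-cong∈ d (λ pa _ → cong (proj₁ pa *_) (eq (proj₂ pa)))

𝔼-return : ∀ (x : A) g → 𝔼 (return x) g ≡ g x
𝔼-return x g = trans (+-identityʳ _) (*-identityˡ _)

𝔼->>= : ∀ (d : Dist A) (f : A → Dist B) g → 𝔼 (d >>= f) g ≡ 𝔼 d (λ a → 𝔼 (f a) g)
𝔼->>= []            f g = refl
𝔼->>= ((p , a) ∷ d) f g = begin
    ∑ (map scaled (f a) ++ (d >>= f)) term
      ≡⟨ ∑-++ (map scaled (f a)) (d >>= f) term ⟩
    ∑ (map scaled (f a)) term + 𝔼 (d >>= f) g
      ≡⟨ cong₂ _+_ (∑-map scaled (f a) term) (𝔼->>= d f g) ⟩
    ∑ (f a) (λ qb → p * proj₁ qb * g (proj₂ qb)) + 𝔼 d (λ a → 𝔼 (f a) g)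
      ≡⟨ cong (_+ 𝔼 d (λ a → 𝔼 (f a) g)) (∑-cong∈ (f a) (λ qb _ → *-assoc p (proj₁ qb) (g (proj₂ qb)))) ⟩
    ∑ (f a) (λ qb → p * (proj₁ qb * g (proj₂ qb))) + 𝔼 d (λ a → 𝔼 (f a) g)
      ≡⟨ cong (_+ 𝔼 d (λ a → 𝔼 (f a) g)) (∑-*ˡ (f a) p (λ qb → proj₁ qb * g (proj₂ qb))) ⟩
    p * 𝔼 (f a) g + 𝔼 d (λ a → 𝔼 (f a) g) ∎
  where
  open ≡-Reasoning
  scaled : _ → _
  scaled qb = p * proj₁ qb , proj₂ qb
  term : _ → ℚ
  term qb = proj₁ qb * g (proj₂ qb)

uniformWeight : List A → ℚ
uniformWeight []       = 0ℚ
uniformWeight (x ∷ xs) = + 1 / suc (length xs)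

𝔼-uniform : ∀ (l : List A) h → 𝔼 (uniform l) h ≡ uniformWeight l * ∑ l h
𝔼-uniform []       h = sym (*-zeroˡ 0ℚ)
𝔼-uniform (x ∷ xs) h =
  trans (∑-map (uniformWeight (x ∷ xs) ,_) (x ∷ xs) (λ pa → proj₁ pa * h (proj₂ pa))) (∑-*ˡ (x ∷ xs) (uniformWeight (x ∷ xs)) h)

dropLast-take : ∀ m (cs : List ℕ) → suc m ≤ length cs → dropLast (take (suc m) cs) ≡ take m cs
dropLast-take zero    (c ∷ cs)      _        = refl
dropLast-take (suc m) (c ∷ c' ∷ cs) (s≤s le) = cong (c ∷_) (dropLast-take m (c' ∷ cs) le)

deduplicate-unique : ∀ {n} (xs : List (Tuple n)) → Unique xs → deduplicate _≟T_ xs ≡ xs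
deduplicate-unique []       _          = refl
deduplicate-unique (x ∷ xs) (x∉xs ∷ u) rewrite deduplicate-unique xs u =
  cong (x ∷_) (LP.filter-all (λ y → ¬? (x ≟T y)) x∉xs)

valid-length : ∀ {n} {S : List (List (Subset n))} F → Valid S F → length (proj₂ F) ≡ length S
valid-length F (_ , resolves , _) = resolvesLength resolves
  where
  resolvesLength : ∀ {n} {S : List (List (Subset n))} {cs Cs} → Resolves S cs Cs → length cs ≡ length S
  resolvesLength []      = refl
  resolvesLength (_ ∷ r) = cong suc (resolvesLength r)

truncate : ∀ {n} → ℕ → Tuple n → Tuple n
truncate i F = proj₁ F , take i (proj₂ F)

module _ {n} {Fk : List (Tuple n)} where

  truncate∈Level : ∀ i {F} → F ∈ Fk → truncate i F ∈ Level Fk i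
  truncate∈Level zero    {F} _   = ∈-map⁺ (_, []) (∈-allFin (proj₁ F))
  truncate∈Level (suc i)     F∈ = ∈-deduplicate⁺ _≟T_ (∈-map⁺ (truncate (suc i)) F∈)

  Level-suc⁻ : ∀ i {F} → F ∈ Level Fk (suc i) → ∃ λ F' → F' ∈ Fk × F ≡ truncate (suc i) F'
  Level-suc⁻ i F∈ = ∈-map⁻ (truncate (suc i)) (∈-deduplicate⁻ _≟T_ _ F∈)

  level-unique : ∀ i → Unique (Level Fk i)
  level-unique zero    = UniqueP.map⁺ (cong proj₁) (UniqueP.allFin⁺ n)
  level-unique (suc i) = UniqueDecP.deduplicate-! _≟T_ _

  level-top : ∀ k → Unique Fk → (∀ F → F ∈ Fk → length (proj₂ F) ≡ suc k) → Level Fk (suc k) ≡ Fk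
  level-top k unique lengths = begin
    deduplicate _≟T_ (map (truncate (suc k)) Fk) ≡⟨ cong (deduplicate _≟T_) (LP.map-id-local (All.tabulate truncate-id)) ⟩
    deduplicate _≟T_ Fk                          ≡⟨ deduplicate-unique Fk unique ⟩
    Fk                                           ∎
    where
    open ≡-Reasoning
    truncate-id : ∀ {F} → F ∈ Fk → truncate (suc k) F ≡ F
    truncate-id {F} F∈ =
      cong (proj₁ F ,_) (LP.take-all (suc k) (proj₂ F) (ℕP.≤-reflexive (lengths F F∈)))

  module _ {k} (lengths : ∀ F → F ∈ Fk → length (proj₂ F) ≡ k) where

    length-level : ∀ i → i ≤ k → ∀ {F} → F ∈ Level Fk i → length (proj₂ F) ≡ i
    length-level zero    _ F∈ with ∈-map⁻ (_, []) F∈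
    ... | _ , _ , refl = refl
    length-level (suc i) i<k F∈ with Level-suc⁻ i F∈
    ... | (G , cs) , F'∈ , refl =
      trans (LP.length-take (suc i) cs) (ℕP.m≤n⇒m⊓n≡m (subst (suc i ≤_) (sym (lengths (G , cs) F'∈)) i<k))

    parent-level : ∀ i → suc i ≤ k → ∀ {F} → F ∈ Level Fk (suc i) → P F ∈ Level Fk i
    parent-level i i<k F∈ with Level-suc⁻ i F∈
    ... | (G , cs) , F'∈ , refl =
      subst (_∈ Level Fk i)
        (cong (G ,_) (sym (dropLast-take i cs (subst (suc i ≤_) (sym (lengths (G , cs) F'∈)) i<k))))
        (truncate∈Level i F'∈)

    b-fiberSize : ∀ i → i ≤ k → ∀ {F} → F ∈ Level Fk i → b Fk F ≡ fiberSize _≟T_ P (Level Fk (suc i)) F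
    b-fiberSize i i≤k {F} F∈ =
      cong (λ j → fiberSize _≟T_ P (Level Fk (suc j)) F) (length-level i i≤k F∈)

-- The acceptance probability a / B of Loosen (0 when B = 0, as in Loosen).
fraction : ℕ → ℕ → ℚ
fraction a zero    = 0ℚ
fraction a (suc m) = + a / suc m

fraction-cancel : ∀ a B → 0 < B → ι B * fraction a B ≡ ι a
fraction-cancel a (suc m) _ = ι-*-/ a m

∏ : (ℕ → ℕ) → ℕ → ℚ
∏ bl zero    = 1ℚ
∏ bl (suc i) = ι (bl i) * ∏ bl i

∏-pos : ∀ bl i → (∀ j → j < i → 0 < bl j) → Positive (∏ bl i)
∏-pos bl zero    _   = _
∏-pos bl (suc i) pos =
  pos*pos⇒pos (ι (bl i)) {{ι-pos (bl i) (pos i ℕP.≤-refl)}} (∏ bl i) {{∏-pos bl i (λ j j<i → pos j (ℕP.m≤n⇒m≤1+n j<i))}}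

count : ∀ {n} → (Maybe (Fin n) → Bool) → ℚ
count {n} E = ∑ (allFin n) (λ G → ind E (just G))

module Output {n} (Fk : List (Tuple n)) (bl : ℕ → ℕ)
              (E : Maybe (Fin n) → Bool) (E-rejects : E nothing ≡ false) where

  payoff : Maybe (Tuple n) → ℚ
  payoff nothing  = 0ℚ
  payoff (just F) = ind E (just (proj₁ F))

  W : ℕ → Tuple n → ℚ
  W j F = 𝔼 (loosenIter Fk bl j (just F)) payoff

  W-rejected : ∀ j → 𝔼 (loosenIter Fk bl j nothing) payoff ≡ 0ℚ
  W-rejected zero    = 𝔼-return nothing payoff
  W-rejected (suc j) = 𝔼-return nothing payoff

  W-step : ∀ j F → W (suc j) F ≡ fraction (bl (length (proj₂ F) ∸ 1)) (b Fk (P F)) * W j (P F)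
  W-step j F = trans (𝔼->>= (Loosen Fk bl F) (loosenIter Fk bl j) payoff) loosenOnce
    where
    continue : Maybe (Tuple n) → ℚ
    continue x = 𝔼 (loosenIter Fk bl j x) payoff
    loosenOnce : 𝔼 (Loosen Fk bl F) continue ≡ fraction (bl (length (proj₂ F) ∸ 1)) (b Fk (P F)) * W j (P F)
    loosenOnce with b Fk (P F)
    ... | zero  = trans (𝔼-return nothing continue) (trans (W-rejected j) (sym (*-zeroˡ (W j (P F)))))
    ... | suc m = begin
      p * W j (P F) + ((1ℚ - p) * continue nothing + 0ℚ)  ≡⟨ cong (_+_ (p * W j (P F))) rejectedMass ⟩
      p * W j (P F) + 0ℚ                                   ≡⟨ +-identityʳ (p * W j (P F)) ⟩
      p * W j (P F)                                        ∎
      where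
      open ≡-Reasoning
      p : ℚ
      p = + bl (length (proj₂ F) ∸ 1) / suc m
      rejectedMass : (1ℚ - p) * continue nothing + 0ℚ ≡ 0ℚ
      rejectedMass = trans (+-identityʳ _) (trans (cong ((1ℚ - p) *_) (W-rejected j)) (*-zeroʳ (1ℚ - p)))

  Relax-W : ∀ k F → 𝔼 (Relax Fk bl k F) (ind E) ≡ W k F
  Relax-W k F = trans (𝔼->>= (loosenIter Fk bl k (just F)) _ (ind E))
    (𝔼-cong (loosenIter Fk bl k (just F)) λ
      { nothing  → trans (𝔼-return nothing (ind E)) (cong (λ t → if t then 1ℚ else 0ℚ) E-rejects)
      ; (just F') → 𝔼-return (just (proj₁ F')) (ind E) })

  mass : ℕ → ℚ
  mass i = ∑ (Level Fk i) (W i)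

  mass-0 : mass 0 ≡ count E
  mass-0 = trans (∑-map (_, []) (allFin n) (W 0)) (∑-cong∈ (allFin n) (λ G _ → 𝔼-return (just (G , [])) payoff))

  module _ (k : ℕ) (lengths : ∀ F → F ∈ Fk → length (proj₂ F) ≡ k)
           (lower : ∀ i → i < k → ∀ F → F ∈ Level Fk i → bl i ≤ b Fk F)
           (lower-pos : ∀ i → i < k → 0 < bl i) where

    -- The level recursion: the fiber sizes b(F) cancel the acceptance probabilities.
    mass-step : ∀ i → suc i ≤ k → mass (suc i) ≡ ι (bl i) * mass i
    mass-step i i<k = begin
      ∑ (Level Fk (suc i)) (W (suc i))
        ≡⟨ ∑-cong∈ (Level Fk (suc i)) (λ F F∈ → trans (W-step i F)
             (cong (λ t → fraction (bl (t ∸ 1)) (b Fk (P F)) * W i (P F)) (length-level lengths (suc i) i<k F∈))) ⟩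
      ∑ (Level Fk (suc i)) (λ F → weighted (P F))
        ≡⟨ ∑-fibers _≟T_ P (Level Fk i) (level-unique i) (Level Fk (suc i)) (λ F → parent-level lengths i i<k) weighted ⟩
      ∑ (Level Fk i) (λ F → ι (fiberSize _≟T_ P (Level Fk (suc i)) F) * weighted F)
        ≡⟨ ∑-cong∈ (Level Fk i) cancel ⟩
      ∑ (Level Fk i) (λ F → ι (bl i) * W i F)
        ≡⟨ ∑-*ˡ (Level Fk i) (ι (bl i)) (W i) ⟩
      ι (bl i) * mass i ∎
      where
      open ≡-Reasoning
      weighted : Tuple n → ℚ
      weighted F = fraction (bl i) (b Fk F) * W i F
      cancel : ∀ F → F ∈ Level Fk i →
               ι (fiberSize _≟T_ P (Level Fk (suc i)) F) * weighted F ≡ ι (bl i) * W i F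
      cancel F F∈ = begin
        ι (fiberSize _≟T_ P (Level Fk (suc i)) F) * weighted F
          ≡⟨ cong (λ B → ι B * weighted F) (sym (b-fiberSize lengths i (ℕP.<⇒≤ i<k) F∈)) ⟩
        ι (b Fk F) * (fraction (bl i) (b Fk F) * W i F)
          ≡⟨ sym (*-assoc (ι (b Fk F)) _ (W i F)) ⟩
        ι (b Fk F) * fraction (bl i) (b Fk F) * W i F
          ≡⟨ cong (_* W i F) (fraction-cancel (bl i) (b Fk F) (ℕP.<-≤-trans (lower-pos i i<k) (lower i i<k F F∈))) ⟩
        ι (bl i) * W i F ∎

    mass-∏ : ∀ i → i ≤ k → mass i ≡ ∏ bl i * mass 0
    mass-∏ zero    _   = sym (*-identityˡ (mass 0))
    mass-∏ (suc i) i<k = begin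
      mass (suc i)                   ≡⟨ mass-step i i<k ⟩
      ι (bl i) * mass i              ≡⟨ cong (ι (bl i) *_) (mass-∏ i (ℕP.<⇒≤ i<k)) ⟩
      ι (bl i) * (∏ bl i * mass 0)   ≡⟨ sym (*-assoc (ι (bl i)) (∏ bl i) (mass 0)) ⟩
      ∏ bl (suc i) * mass 0          ∎
      where open ≡-Reasoning

  Pr-experiment : ∀ k → Unique Fk → (∀ F → F ∈ Fk → length (proj₂ F) ≡ suc k) →
                  (∀ i → i < suc k → ∀ F → F ∈ Level Fk i → bl i ≤ b Fk F) →
                  (∀ i → i < suc k → 0 < bl i) →
                  Pr (experiment Fk bl (suc k)) E ≡ uniformWeight Fk * ∏ bl (suc k) * count E
  Pr-experiment k unique lengths lower lower-pos = begin
    Pr (experiment Fk bl (suc k)) E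
      ≡⟨ Pr-𝔼 (experiment Fk bl (suc k)) E ⟩
    𝔼 (uniform Fk >>= Relax Fk bl (suc k)) (ind E)
      ≡⟨ 𝔼->>= (uniform Fk) (Relax Fk bl (suc k)) (ind E) ⟩
    𝔼 (uniform Fk) (λ F → 𝔼 (Relax Fk bl (suc k) F) (ind E))
      ≡⟨ 𝔼-cong (uniform Fk) (Relax-W (suc k)) ⟩
    𝔼 (uniform Fk) (W (suc k))
      ≡⟨ 𝔼-uniform Fk (W (suc k)) ⟩
    uniformWeight Fk * ∑ Fk (W (suc k))
      ≡⟨ cong (λ L → uniformWeight Fk * ∑ L (W (suc k))) (sym (level-top k unique lengths)) ⟩
    uniformWeight Fk * mass (suc k)
      ≡⟨ cong (uniformWeight Fk *_) (mass-∏ (suc k) lengths lower lower-pos (suc k) ℕP.≤-refl) ⟩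
    uniformWeight Fk * (∏ bl (suc k) * mass 0)
      ≡⟨ cong (λ x → uniformWeight Fk * (∏ bl (suc k) * x)) mass-0 ⟩
    uniformWeight Fk * (∏ bl (suc k) * count E)
      ≡⟨ sym (*-assoc (uniformWeight Fk) (∏ bl (suc k)) (count E)) ⟩
    uniformWeight Fk * ∏ bl (suc k) * count E ∎
    where open ≡-Reasoning

count-accepted : ∀ n → count {n} accepted ≡ ι n
count-accepted n = trans (∑-const (allFin n) 1ℚ)
  (trans (cong (λ m → ι m * 1ℚ) (LP.length-tabulate {n = n} (λ (i : Fin n) → i))) (*-identityʳ (ι n)))

count-outputIs : ∀ {n} (G : Fin n) → count (outputIs G) ≡ 1ℚ
count-outputIs {n} G = ∑-atPoint Fin._≟_ (allFin n) (UniqueP.allFin⁺ n) (∈-allFin G) (λ _ → 1ℚ)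

corollary3p2 : (n k : ℕ) → 1 ≤ k
    → (S : List (List (Subset n))) → length S ≡ k
    → (Fk : List (Tuple n)) → Unique Fk → Fk ≢ []
    → (∀ F → F ∈ Fk → Valid S F)
    → (bl : ℕ → ℕ)
    → (∀ i → i < k → ∀ F → F ∈ Level Fk i → bl i ≤ b Fk F)
    → (∀ i → i < k → 0 < bl i)
    → (0ℚ <ℚ Pr (experiment Fk bl k) accepted)
    × (∀ (G : Fin n) → Pr (experiment Fk bl k) (outputIs G) * (+ n / 1) ≡ Pr (experiment Fk bl k) accepted)
corollary3p2 n zero () _ _ _ _ _ _ _ _ _
corollary3p2 n (suc k) _ _ _ [] _ nonempty _ _ _ _ = ⊥-elim (nonempty refl)
corollary3p2 n (suc k) _ _ lenS Fk@((G₀ , _) ∷ rest) unique _ valid bl lower lower-pos =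
  positive⁻¹ _ {{subst Positive (sym Pr-accepted) c*n-pos}} , output-uniform
  where
  lengths : ∀ F → F ∈ Fk → length (proj₂ F) ≡ suc k
  lengths F F∈ = trans (valid-length F (valid F F∈)) lenS
  c : ℚ
  c = uniformWeight Fk * ∏ bl (suc k)
  Pr-accepted : Pr (experiment Fk bl (suc k)) accepted ≡ c * ι n
  Pr-accepted = trans (Output.Pr-experiment Fk bl accepted refl k unique lengths lower lower-pos)
                      (cong (c *_) (count-accepted n))
  Pr-output : ∀ G → Pr (experiment Fk bl (suc k)) (outputIs G) ≡ c
  Pr-output G = trans (Output.Pr-experiment Fk bl (outputIs G) refl k unique lengths lower lower-pos)
                      (trans (cong (c *_) (count-outputIs G)) (*-identityʳ c))
  c*n-pos : Positive (c * ι n)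
  c*n-pos = pos*pos⇒pos c {{c-pos}} (ι n) {{ι-pos-Fin G₀}}
    where
    c-pos : Positive c
    c-pos = pos*pos⇒pos (uniformWeight Fk) {{normalize-pos 1 (suc (length rest))}}
                        (∏ bl (suc k)) {{∏-pos bl (suc k) lower-pos}}
  output-uniform : ∀ G → Pr (experiment Fk bl (suc k)) (outputIs G) * ι n ≡ Pr (experiment Fk bl (suc k)) accepted
  output-uniform G = trans (cong (_* ι n) (Pr-output G)) (sym Pr-accepted)
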